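{- Every bipartite strongly distance-regular graph with diameter $d=4$ is antipodal.
   Context: A connected graph $G$ of diameter $d$ is distance-regular if for any two vertices $u,v$ at distance $i$, the numbers of neighbours of $v$ at distance $i-1$, $i$, $i+1$ from $u$ depend only on $i$. The distance-$d$ graph $G_d$ of $G$ has the same vertex set as $G$, with two vertices adjacent iff they are at distance $d$ in $G$. $G$ is strongly distance-regular if it is distance-regular and $G_d$ is strongly regular. $G$ is antipodal if $G_d$ is a disjoint union of complete graphs (equivalently, being equal or at distance $d$ is an equivalence relation on the vertices). -}

module Defs where

open import Data.Nat using (ℕ; zero; suc; _+_; _≤_)
open import Data.Bool using (Bool; true; false; _∧_; _∨_; not; if_then_else_)
open import Data.Fin using (Fin; _≟_)
open import Relation.Nullary.Decidable using (⌊_⌋)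
open import Data.Product using (Σ; ∃; _×_; _,_)
open import Data.Sum using (_⊎_)
open import Relation.Binary.PropositionalEquality using (_≡_; _≢_)
open import Relation.Binary.Structures using (IsEquivalence)

record Graph : Set where
  field
    n      : ℕ
    adj    : Fin n → Fin n → Bool
    sym    : ∀ u v → adj u v ≡ adj v u
    irrefl : ∀ v → adj v v ≡ false

count : (m : ℕ) → (Fin m → Bool) → ℕ
count zero    p = 0
count (suc m) p = (if p Fin.zero then 1 else 0) + count m (λ i → p (Fin.suc i))

anyFin : (m : ℕ) → (Fin m → Bool) → Bool
anyFin zero    p = false
anyFin (suc m) p = p Fin.zero ∨ anyFin m (λ i → p (Fin.suc i))

module _ (G : Graph) where
  open Graph G

  eqB : Fin n → Fin n → Bool
  eqB u v = ⌊ u ≟ v ⌋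

  reach : ℕ → Fin n → Fin n → Bool
  reach zero    u v = eqB u v
  reach (suc k) u v = reach k u v ∨ anyFin n (λ w → reach k u w ∧ adj w v)

  atDist : ℕ → Fin n → Fin n → Bool
  atDist zero    u v = reach zero u v
  atDist (suc i) u v = reach (suc i) u v ∧ not (reach i u v)

  nbrsAt : ℕ → Fin n → Fin n → ℕ
  nbrsAt j u v = count n (λ w → adj v w ∧ atDist j u w)

  Connected : Set
  Connected = ∀ u v → ∃ λ k → reach k u v ≡ true

  HasDiameter : ℕ → Set
  HasDiameter d = Connected × (∀ u v → reach d u v ≡ true)
                  × (Σ (Fin n) λ u → Σ (Fin n) λ v → atDist d u v ≡ true)

  -- the numbers c_i, a_i, b_i depend only on i
  -- (c_0 is always 0, so c is only constrained for i ≥ 1)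
  IsDistanceRegular : ℕ → Set
  IsDistanceRegular d = HasDiameter d ×
    (∀ i u v u' v' → atDist i u v ≡ true → atDist i u' v' ≡ true →
        nbrsAt i u v ≡ nbrsAt i u' v'
      × nbrsAt (suc i) u v ≡ nbrsAt (suc i) u' v'
      × (∀ j → i ≡ suc j → nbrsAt j u v ≡ nbrsAt j u' v'))

  Bipartite : Set
  Bipartite = Σ (Fin n → Bool) λ col → ∀ u v → adj u v ≡ true → col u ≢ col v

  -- strong regularity of a (symmetric, loopless) Boolean relation R on the
  -- vertex set, read as a graph: k-regular, adjacent pairs have λ common
  -- neighbours, distinct non-adjacent pairs have μ common neighbours.
  -- (Degenerate cases such as disjoint unions of complete graphs allowed.)
  IsStronglyRegular : (Fin n → Fin n → Bool) → Set
  IsStronglyRegular R = Σ ℕ λ k → Σ ℕ λ l → Σ ℕ λ m →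
      (∀ v → count n (R v) ≡ k)
    × (∀ u v → R u v ≡ true → count n (λ w → R u w ∧ R v w) ≡ l)
    × (∀ u v → u ≢ v → R u v ≡ false → count n (λ w → R u w ∧ R v w) ≡ m)

  IsStronglyDistanceRegular : ℕ → Set
  IsStronglyDistanceRegular d = IsDistanceRegular d × IsStronglyRegular (atDist d)

  IsAntipodal : ℕ → Set
  IsAntipodal d = IsEquivalence (λ u v → u ≡ v ⊎ atDist d u v ≡ true)

-- In a bipartite graph two vertices at even distance have the same colour. An
-- edge x y (which exists, as the diameter is positive) is therefore a pair of
-- distinct vertices that are neither at distance 4 nor have a common vertex at
-- distance 4 from both, so the parameter μ of the strongly regular distance-4
-- graph is 0. With μ = 0, two vertices at distance 4 from a common vertex are
-- equal or at distance 4 themselves, which is transitivity of the antipodal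
-- relation.
module Submission where

open import Defs
open import Data.Nat using (ℕ; zero; suc; _*_; _≤_; _≤′_; ≤′-refl; ≤′-step; z≤n; s≤s)
open import Data.Nat.Properties using (≤⇒≤′; m≤n⇒m<n∨m≡n; m≤n⇒m≤1+n)
open import Data.Nat.GeneralisedArithmetic using (fold)
open import Data.Bool using (Bool; true; false; _∧_; _∨_; not)
open import Data.Bool.Properties using (∨-zeroʳ; not-involutive; ¬-not)
open import Data.Fin using (Fin; _≟_)
open import Data.Product using (∃; _×_; _,_)
open import Data.Sum using (_⊎_; inj₁; inj₂)
open import Relation.Nullary using (yes; no; ¬_; contradiction)
open import Relation.Binary.Definitions using (DecidableEquality)
open import Relation.Binary.Structures using (IsEquivalence)
open import Relation.Binary.PropositionalEquality
  using (_≡_; _≢_; refl; sym; trans; cong)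

∧-≡true⁻ : ∀ {a b} → a ∧ b ≡ true → a ≡ true × b ≡ true
∧-≡true⁻ {true} {true} _ = refl , refl

∧-≡true⁺ : ∀ {a b} → a ≡ true → b ≡ true → a ∧ b ≡ true
∧-≡true⁺ refl refl = refl

not-≡true⁻ : ∀ {b} → not b ≡ true → ¬ (b ≡ true)
not-≡true⁻ {true} ()

fold-not-even : ∀ i b → fold b not (i * 2) ≡ b
fold-not-even zero    b = refl
fold-not-even (suc i) b = trans (not-involutive _) (fold-not-even i b)

count-allFalse : ∀ m (p : Fin m → Bool) → (∀ i → p i ≡ false) → count m p ≡ 0
count-allFalse zero    p _     = refl
count-allFalse (suc m) p none rewrite none Fin.zero =
  count-allFalse m (λ j → p (Fin.suc j)) (λ j → none (Fin.suc j))

count-≡0⇒false : ∀ m (p : Fin m → Bool) i → count m p ≡ 0 → p i ≡ false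
count-≡0⇒false (suc m) p Fin.zero    c with p Fin.zero
... | false = refl
count-≡0⇒false (suc m) p (Fin.suc i) c with p Fin.zero
... | false = count-≡0⇒false m (λ j → p (Fin.suc j)) i c

anyFin⇒∃ : ∀ m (p : Fin m → Bool) → anyFin m p ≡ true → ∃ λ i → p i ≡ true
anyFin⇒∃ (suc m) p any with p Fin.zero in p0
... | true  = Fin.zero , p0
... | false with anyFin⇒∃ m (λ j → p (Fin.suc j)) any
...   | i , pi = Fin.suc i , pi

∃⇒anyFin : ∀ m (p : Fin m → Bool) i → p i ≡ true → anyFin m p ≡ true
∃⇒anyFin (suc m) p Fin.zero    pi rewrite pi = refl
∃⇒anyFin (suc m) p (Fin.suc i) pi with p Fin.zero
... | true  = refl
... | false = ∃⇒anyFin m (λ j → p (Fin.suc j)) i pi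

module _ {A : Set} (_≟ᴬ_ : DecidableEquality A) {R : A → A → Bool}
         (R-sym : ∀ {u v} → R u v ≡ true → R v u ≡ true)
         (R-closed : ∀ {u v w} → R u v ≡ true → R w v ≡ true → u ≢ w → R u w ≡ true)
         where

  ≡⊎R-isEquivalence : IsEquivalence (λ u v → u ≡ v ⊎ R u v ≡ true)
  ≡⊎R-isEquivalence = record { refl = inj₁ refl ; sym = symmetric ; trans = transitive }
    where
      symmetric : ∀ {u v} → u ≡ v ⊎ R u v ≡ true → v ≡ u ⊎ R v u ≡ true
      symmetric (inj₁ u≡v) = inj₁ (sym u≡v)
      symmetric (inj₂ ruv) = inj₂ (R-sym ruv)

      transitive : ∀ {u v w} → u ≡ v ⊎ R u v ≡ true → v ≡ w ⊎ R v w ≡ true →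
                   u ≡ w ⊎ R u w ≡ true
      transitive (inj₁ refl) vw          = vw
      transitive (inj₂ ruv)  (inj₁ refl) = inj₂ ruv
      transitive {u} {v} {w} (inj₂ ruv) (inj₂ rvw) with u ≟ᴬ w
      ... | yes u≡w = inj₁ u≡w
      ... | no  u≢w = inj₂ (R-closed ruv (R-sym rvw) u≢w)

module _ (G : Graph) where
  open Graph G using (n; adj)

  data Walk (u : Fin n) : Fin n → ℕ → Set where
    []  : Walk u u 0
    _▷_ : ∀ {v w j} → Walk u v j → adj v w ≡ true → Walk u w (suc j)

  Walk-cons : ∀ {u v w j} → adj u v ≡ true → Walk v w j → Walk u w (suc j)
  Walk-cons uv []         = [] ▷ uv
  Walk-cons uv (p ▷ vw) = Walk-cons uv p ▷ vw

  Walk-reverse : ∀ {u v j} → Walk u v j → Walk v u j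
  Walk-reverse []                         = []
  Walk-reverse (_▷_ {v = v} {w = w} p vw) =
    Walk-cons (trans (Graph.sym G w v) vw) (Walk-reverse p)

  reach-suc : ∀ {k u v} → reach G k u v ≡ true → reach G (suc k) u v ≡ true
  reach-suc {k} {u} {v} r = cong (_∨ anyFin n (λ w → reach G k u w ∧ adj w v)) r

  reach-mono : ∀ {j k u v} → j ≤ k → reach G j u v ≡ true → reach G k u v ≡ true
  reach-mono j≤k = go (≤⇒≤′ j≤k)
    where
      go : ∀ {j k u v} → j ≤′ k → reach G j u v ≡ true → reach G k u v ≡ true
      go ≤′-refl                     r = r
      go {u = u} {v} (≤′-step {k} j≤k) r = reach-suc {k} {u} {v} (go j≤k r)

  Walk⇒reach : ∀ {u v j} → Walk u v j → reach G j u v ≡ true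
  Walk⇒reach {u} [] with u ≟ u
  ... | yes _   = refl
  ... | no  u≢u = contradiction refl u≢u
  Walk⇒reach {u} {w} {suc j} (_▷_ {v = v} p vw) =
    trans (cong (reach G j u w ∨_) viaV) (∨-zeroʳ _)
    where
      viaV : anyFin n (λ x → reach G j u x ∧ adj x w) ≡ true
      viaV = ∃⇒anyFin n _ v (∧-≡true⁺ (Walk⇒reach p) vw)

  reach⇒Walk : ∀ k u v → reach G k u v ≡ true → ∃ λ j → j ≤ k × Walk u v j
  reach⇒Walk zero u v r with u ≟ v
  reach⇒Walk zero u .u r | yes refl = 0 , z≤n , []
  reach⇒Walk (suc k) u v r with reach G k u v in rk
  ... | true with reach⇒Walk k u v rk
  ...   | j , j≤k , p = j , m≤n⇒m≤1+n j≤k , p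
  reach⇒Walk (suc k) u v r | false with anyFin⇒∃ n _ r
  ... | w , rw with ∧-≡true⁻ {reach G k u w} rw
  ...   | ruw , wv with reach⇒Walk k u w ruw
  ...     | j , j≤k , p = suc j , s≤s j≤k , p ▷ wv

  reach-sym : ∀ {k u v} → reach G k u v ≡ true → reach G k v u ≡ true
  reach-sym {k} {u} {v} r with reach⇒Walk k u v r
  ... | j , j≤k , p = reach-mono j≤k (Walk⇒reach (Walk-reverse p))

  atDist-sym : ∀ {k u v} → atDist G k u v ≡ true → atDist G k v u ≡ true
  atDist-sym {zero}  {u} {v} r = reach-sym {0} {u} {v} r
  atDist-sym {suc k} {u} {v} r with ∧-≡true⁻ {reach G (suc k) u v} r
  ... | rk+1 , ¬rk =
    ∧-≡true⁺ (reach-sym {suc k} {u} {v} rk+1)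
             (cong not (¬-not λ rk → not-≡true⁻ ¬rk (reach-sym {k} {v} {u} rk)))

  atDist⇒Walk : ∀ k u v → atDist G k u v ≡ true → Walk u v k
  atDist⇒Walk zero u v r with u ≟ v
  atDist⇒Walk zero u .u r | yes refl = []
  atDist⇒Walk (suc k) u v r with ∧-≡true⁻ r
  ... | rk+1 , ¬rk with reach⇒Walk (suc k) u v rk+1
  ...   | j , j≤k+1 , p with m≤n⇒m<n∨m≡n j≤k+1
  ...     | inj₂ refl         = p
  ...     | inj₁ (s≤s j≤k)    = contradiction (reach-mono j≤k (Walk⇒reach p)) (not-≡true⁻ ¬rk)

  adj⇒≢ : ∀ {u v} → adj u v ≡ true → u ≢ v
  adj⇒≢ {u} uv refl with trans (sym uv) (Graph.irrefl G u)
  ... | ()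

  module _ (col : Fin n → Bool) (proper : ∀ u v → adj u v ≡ true → col u ≢ col v) where

    Walk-colour : ∀ {u v j} → Walk u v j → col v ≡ fold (col u) not j
    Walk-colour [] = refl
    Walk-colour (_▷_ {v = v} {w = w} p vw) =
      trans (¬-not λ cw≡cv → proper v w vw (sym cw≡cv)) (cong not (Walk-colour p))

    atDist-even-sameColour : ∀ i {u v} → atDist G (i * 2) u v ≡ true → col v ≡ col u
    atDist-even-sameColour i {u} {v} r =
      trans (Walk-colour (atDist⇒Walk (i * 2) u v r)) (fold-not-even i (col u))

    adj⇒¬atDist-even : ∀ i {x y} → adj x y ≡ true → atDist G (i * 2) x y ≡ false
    adj⇒¬atDist-even i {x} {y} xy with atDist G (i * 2) x y in rxy
    ... | false = refl
    ... | true  = contradiction (sym (atDist-even-sameColour i rxy)) (proper x y xy)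

    adj⇒noCommonAtDist-even : ∀ i {x y} → adj x y ≡ true →
                              ∀ z → atDist G (i * 2) x z ∧ atDist G (i * 2) y z ≡ false
    adj⇒noCommonAtDist-even i {x} {y} xy z
      with atDist G (i * 2) x z in rxz | atDist G (i * 2) y z in ryz
    ... | false | _     = refl
    ... | true  | false = refl
    ... | true  | true  =
      contradiction (trans (sym (atDist-even-sameColour i rxz)) (atDist-even-sameColour i ryz))
                    (proper x y xy)

  module _ {R : Fin n → Fin n → Bool} where

    μ-vanishes⇒closed :
      (∀ u w → u ≢ w → R u w ≡ false → count n (λ z → R u z ∧ R w z) ≡ 0) →
      ∀ {u v w} → R u v ≡ true → R w v ≡ true → u ≢ w → R u w ≡ true
    μ-vanishes⇒closed μ≡0 {u} {v} {w} ruv rwv u≢w with R u w in ruw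
    ... | true  = refl
    ... | false with trans (sym (∧-≡true⁺ ruv rwv)) (count-≡0⇒false n _ v (μ≡0 u w u≢w ruw))
    ...   | ()

    separatedPair⇒μ-vanishes : IsStronglyRegular G R →
      ∀ {x y} → x ≢ y → R x y ≡ false → (∀ z → R x z ∧ R y z ≡ false) →
      ∀ u w → u ≢ w → R u w ≡ false → count n (λ z → R u z ∧ R w z) ≡ 0
    separatedPair⇒μ-vanishes (_ , _ , _ , _ , _ , μ) x≢y rxy noCommon u w u≢w ruw =
      trans (μ u w u≢w ruw) (trans (sym (μ _ _ x≢y rxy)) (count-allFalse n _ noCommon))

mainTheorem3 : (G : Graph) → Bipartite G → IsStronglyDistanceRegular G 4 →
    IsAntipodal G 4
mainTheorem3 G (col , proper) (((_ , _ , a , b , rab) , _) , srg)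
  with atDist⇒Walk G 4 a b rab
... | _▷_ {v = x} _ xb =
  ≡⊎R-isEquivalence _≟_ (λ {u} {v} → atDist-sym G {4} {u} {v})
    (μ-vanishes⇒closed G
      (separatedPair⇒μ-vanishes G srg (adj⇒≢ G xb)
        (adj⇒¬atDist-even G col proper 2 xb) (adj⇒noCommonAtDist-even G col proper 2 xb)))
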